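{- Let $k,m$ be positive integers, let $P_i$ be a string, and for $j\ge1$ let $P_{i,j}$ and $P_{i,j-1}$ be the prefixes of $P_i$ of lengths $2^j$ and $2^{j-1}$, with periods $\rho_{i,j}$ and $\rho_{i,j-1}$ respectively, such that $\rho_{i,j-1}<k\log m\le\rho_{i,j}$. Let $T$ be a text and let $p_1<p_2<\dots<p_s$ be a match progression of $P_{i,j-1}$ in $T$, i.e. positions at which occurrences of $P_{i,j-1}$ in $T$ start, with $p_{t+1}-p_t=\rho_{i,j-1}$ for all $t$. Then at most one of the positions $p_1,\dots,p_s$ is also the starting position of an occurrence of $P_{i,j}$ in $T$.
   Context: An integer $p$ with $0<p\le|x|$ is a period of a nonempty string $x$ if $x_i=x_{i+p}$ for all valid $i$; "the period" of $x$ means its smallest period. Logarithms are base 2, rounded to the nearest integer. -}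

module Defs where

open import Level using (Level)
open import Data.Nat using (ℕ; zero; suc; _+_; _*_; _∸_; _^_; _≤_; _<_; _/_)
open import Data.Nat.Logarithm using (⌊log₂_⌋)
open import Data.Fin using (fromℕ<)
open import Data.List using (List; length; lookup; take; drop)
open import Data.Product using (_×_)
open import Relation.Binary.PropositionalEquality using (_≡_)

private variable a : Level

IsPeriodOf : {A : Set a} → ℕ → List A → Set a
IsPeriodOf {A = A} p x =
  (0 < p) × (p ≤ length x) ×
  (∀ i (h₁ : i < length x) (h₂ : i + p < length x) →
     lookup x (fromℕ< h₁) ≡ lookup x (fromℕ< h₂))

IsThePeriod : {A : Set a} → ℕ → List A → Set a
IsThePeriod p x = IsPeriodOf p x × (∀ q → IsPeriodOf q x → p ≤ q)

OccursAt : {A : Set a} → List A → List A → ℕ → Set a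
OccursAt Q T p = take (length Q) (drop p T) ≡ Q

-- log₂ m rounded to the nearest integer: the unique l with
-- 2^(l-1/2) ≤ m < 2^(l+1/2), i.e. 2^(2l) ≤ 2m² < 2^(2l+2)
-- (no ties occur for natural m), so l = ⌊ ⌊log₂(2m²)⌋ / 2 ⌋.
logRound : ℕ → ℕ
logRound m = ⌊log₂ (2 * (m * m)) ⌋ / 2

module Submission where

-- Let p₁ < p₂ < … be a match progression of a pattern of length n with step ρ ≤ n.
-- Consecutive occurrences overlap by n - ρ ≥ 0, so the whole stretch of text they cover
-- is ρ-periodic (gluing lemma).  Suppose the longer pattern P' occurs at two positions
-- q < q' = q + d of the progression.  Two occurrences at distance d make the text
-- d-periodic on [q, q' + |P'|), and the progression makes it ρ-periodic on the first
-- d + ρ positions; a d-periodic word whose first d + ρ letters are ρ-periodic is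
-- ρ-periodic throughout (period extension).  Hence ρ = ρ_{i,j-1} is a period of
-- P' = P_{i,j}, contradicting ρ_{i,j-1} < k log m ≤ ρ_{i,j} = the least period of P_{i,j}.

open import Defs
open import Level using (Level)
open import Data.Nat using (ℕ; suc; _+_; _*_; _∸_; _^_; _≤_; _<_)
open import Data.List using (List; length; take)
open import Relation.Binary.PropositionalEquality using (_≡_)

open import Data.Nat using (zero; z≤n; s≤s; _<?_)
open import Data.Nat.Properties
open import Data.Nat.Induction using (<-rec)
open import Algebra.Properties.CommutativeSemigroup +-commutativeSemigroup
  using (xy∙z≈xz∙y)
open import Data.List using ([]; _∷_; drop; lookup)
open import Data.List.Properties using (length-take)
open import Data.Maybe using (Maybe; just; nothing)
open import Data.Maybe.Properties using (just-injective)
open import Data.Fin using (fromℕ<)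
open import Data.Product using (_×_; _,_)
open import Data.Sum using (inj₁; inj₂)
open import Data.Empty using (⊥; ⊥-elim)
open import Relation.Nullary using (yes; no)
open import Relation.Binary.Definitions using (tri<; tri≈; tri>)
open import Relation.Binary.PropositionalEquality
  using (refl; sym; trans; cong; subst; module ≡-Reasoning)

open ≡-Reasoning

private variable
  a b ℓ : Level
  A : Set a
  B : Set b

PeriodicOn : (ℕ → B) → ℕ → ℕ → ℕ → Set _
PeriodicOn u ρ lo hi = ∀ x → lo ≤ x → x + ρ < hi → u x ≡ u (x + ρ)

OccursIn : (ℕ → B) → ℕ → (ℕ → B) → ℕ → Set _
OccursIn u q g n = ∀ i → i < n → u (q + i) ≡ g i

twin-period : ∀ {u g : ℕ → B} {q q' d n} → q' ≡ q + d →
              OccursIn u q g n → OccursIn u q' g n → PeriodicOn u d q (q' + n)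
twin-period {u = u} {g} {q} {d = d} {n} refl occ occ' x q≤x x+d<end
  with i , refl ← m≤n⇒∃[o]m+o≡n q≤x =
  begin
    u (q + i)      ≡⟨ occ i i<n ⟩
    g i            ≡⟨ sym (occ' i i<n) ⟩
    u (q + d + i)  ≡⟨ cong u (xy∙z≈xz∙y q d i) ⟩
    u (q + i + d)  ∎
  where
  i<n : i < n
  i<n = +-cancelˡ-< (q + d) i n (subst (_< q + d + n) (xy∙z≈xz∙y q i d) x+d<end)

glue : ∀ {u : ℕ → B} {ρ lo a b c} → b + ρ ≤ a →
       PeriodicOn u ρ lo a → PeriodicOn u ρ b c → PeriodicOn u ρ lo c
glue {ρ = ρ} {a = a} {b} b+ρ≤a left right x lo≤x x+ρ<c with x + ρ <? a
... | yes x+ρ<a = left x lo≤x x+ρ<a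
... | no  x+ρ≮a = right x (+-cancelʳ-≤ ρ b x (≤-trans b+ρ≤a (≮⇒≥ x+ρ≮a))) x+ρ<c

period-extend : ∀ {u : ℕ → B} {d ρ lo hi m} → 0 < d → lo + d + ρ ≤ m →
                PeriodicOn u d lo hi → PeriodicOn u ρ lo m → PeriodicOn u ρ lo hi
period-extend {u = u} {d} {ρ} {lo} {hi} 0<d prefix perD perρ x = <-rec Goal step x
  where
  Goal : ℕ → Set _
  Goal x = lo ≤ x → x + ρ < hi → u x ≡ u (x + ρ)

  step : ∀ x → (∀ {y} → y < x → Goal y) → Goal x
  step x ih lo≤x x+ρ<hi with x <? lo + d
  ... | yes x<lo+d = perρ x lo≤x (<-≤-trans (+-monoˡ-< ρ x<lo+d) prefix)
  ... | no  x≮lo+d with y , refl ← m≤n⇒∃[o]m+o≡n (≤-trans (m≤n+m d lo) (≮⇒≥ x≮lo+d)) =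
    begin
      u (d + y)      ≡⟨ cong u (+-comm d y) ⟩
      u (y + d)      ≡⟨ sym (perD y lo≤y y+d<hi) ⟩
      u y            ≡⟨ ih (m<n+m y 0<d) lo≤y (≤-<-trans (+-monoˡ-≤ ρ (m≤n+m y d)) x+ρ<hi) ⟩
      u (y + ρ)      ≡⟨ perD (y + ρ) (≤-trans lo≤y (m≤m+n y ρ)) (subst (_< hi) shuffle x+ρ<hi) ⟩
      u (y + ρ + d)  ≡⟨ cong u (sym shuffle) ⟩
      u (d + y + ρ)  ∎
    where
    shuffle : d + y + ρ ≡ y + ρ + d
    shuffle = trans (cong (_+ ρ) (+-comm d y)) (xy∙z≈xz∙y y d ρ)

    lo≤y : lo ≤ y
    lo≤y = +-cancelʳ-≤ d lo y (subst (lo + d ≤_) (+-comm d y) (≮⇒≥ x≮lo+d))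

    y+d<hi : y + d < hi
    y+d<hi = ≤-<-trans (≤-reflexive (+-comm y d)) (≤-<-trans (m≤m+n (d + y) ρ) x+ρ<hi)

pattern-period : ∀ {u g : ℕ → B} {q n ρ hi} → q + n ≤ hi →
                 OccursIn u q g n → PeriodicOn u ρ q hi → PeriodicOn g ρ 0 n
pattern-period {u = u} {g} {q} {n} {ρ} {hi} inside occ per i _ i+ρ<n =
  begin
    g i              ≡⟨ sym (occ i (≤-<-trans (m≤m+n i ρ) i+ρ<n)) ⟩
    u (q + i)        ≡⟨ per (q + i) (m≤m+n q i) (<-≤-trans q+i+ρ<q+n inside) ⟩
    u (q + i + ρ)    ≡⟨ cong u (+-assoc q i ρ) ⟩
    u (q + (i + ρ))  ≡⟨ occ (i + ρ) i+ρ<n ⟩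
    g (i + ρ)        ∎
  where
  q+i+ρ<q+n : q + i + ρ < q + n
  q+i+ρ<q+n = subst (_< q + n) (sym (+-assoc q i ρ)) (+-monoʳ-< q i+ρ<n)

module MatchProgression {u g : ℕ → B} {n ρ s : ℕ} {p : ℕ → ℕ}
  (0<ρ : 0 < ρ) (ρ≤n : ρ ≤ n)
  (occ : ∀ t → t < s → OccursIn u (p t) g n)
  (step : ∀ t → suc t < s → p (suc t) ≡ p t + ρ) where

  step-increasing : ∀ {t} → suc t < s → p t < p (suc t)
  step-increasing {t} st<s = subst (p t <_) (sym (step t st<s)) (m<m+n (p t) 0<ρ)

  step-periodic : ∀ {t} → suc t < s → PeriodicOn u ρ (p t) (p (suc t) + n)
  step-periodic {t} st<s =
    twin-period (step t st<s) (occ t (<-trans (n<1+n t) st<s)) (occ (suc t) st<s)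

  increasing : ∀ {t t'} → t < t' → t' < s → p t < p t'
  increasing {t} {suc t'} (s≤s t≤t') st'<s with m≤n⇒m<n∨m≡n t≤t'
  ... | inj₂ refl = step-increasing st'<s
  ... | inj₁ t<t' =
    <-trans (increasing t<t' (<-trans (n<1+n t') st'<s)) (step-increasing st'<s)

  covered-periodic : ∀ {t t'} → t < t' → t' < s → PeriodicOn u ρ (p t) (p t' + n)
  covered-periodic {t} {suc t'} (s≤s t≤t') st'<s with m≤n⇒m<n∨m≡n t≤t'
  ... | inj₂ refl = step-periodic st'<s
  ... | inj₁ t<t' =
    glue (+-monoʳ-≤ (p t') ρ≤n)
      (covered-periodic t<t' (<-trans (n<1+n t') st'<s)) (step-periodic st'<s)

  two-matches-periodic : ∀ {g' : ℕ → B} {n' t t'} → t < t' → t' < s →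
                         OccursIn u (p t) g' n' → OccursIn u (p t') g' n' →
                         PeriodicOn g' ρ 0 n'
  two-matches-periodic {n' = n'} {t} {t'} t<t' t'<s occ₁ occ₂ =
    pattern-period (+-monoˡ-≤ n' (<⇒≤ p<p'))
      occ₁ (period-extend (m<n⇒0<n∸m p<p') prefix
              (twin-period gap occ₁ occ₂) (covered-periodic t<t' t'<s))
    where
    p<p' : p t < p t'
    p<p' = increasing t<t' t'<s

    d : ℕ
    d = p t' ∸ p t

    gap : p t' ≡ p t + d
    gap = sym (m+[n∸m]≡n (<⇒≤ p<p'))

    prefix : p t + d + ρ ≤ p t' + n
    prefix = subst (λ z → z + ρ ≤ p t' + n) gap (+-monoʳ-≤ (p t') ρ≤n)

at-most-one : {Q : ℕ → Set ℓ} → (∀ {t t'} → t < t' → Q t → Q t' → ⊥) →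
              ∀ {t t'} → Q t → Q t' → t ≡ t'
at-most-one no-pair {t} {t'} Qt Qt' with <-cmp t t'
... | tri< t<t' _ _ = ⊥-elim (no-pair t<t' Qt Qt')
... | tri≈ _ t≡t' _ = t≡t'
... | tri> _ _ t'<t = ⊥-elim (no-pair t'<t Qt' Qt)

at : List A → ℕ → Maybe A
at []       _       = nothing
at (x ∷ xs) zero    = just x
at (x ∷ xs) (suc i) = at xs i

at-take : ∀ n (xs : List A) {i} → i < n → at (take n xs) i ≡ at xs i
at-take (suc n) []       _       = refl
at-take (suc n) (x ∷ xs) {zero}  _        = refl
at-take (suc n) (x ∷ xs) {suc i} (s≤s i<n) = at-take n xs i<n

at-drop : ∀ q (xs : List A) i → at (drop q xs) i ≡ at xs (q + i)
at-drop zero    xs       i = refl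
at-drop (suc q) []       i = refl
at-drop (suc q) (x ∷ xs) i = at-drop q xs i

at-lookup : ∀ (xs : List A) {i} (i<∣xs∣ : i < length xs) →
            at xs i ≡ just (lookup xs (fromℕ< i<∣xs∣))
at-lookup (x ∷ xs) {zero}  _         = refl
at-lookup (x ∷ xs) {suc i} (s≤s i<∣xs∣) = at-lookup xs i<∣xs∣

length-prefix : ∀ {n} (P : List A) → n ≤ length P → length (take n P) ≡ n
length-prefix {n = n} P n≤∣P∣ = trans (length-take n P) (m≤n⇒m⊓n≡m n≤∣P∣)

occursAt-prefix : ∀ {n} (P T : List A) q → n ≤ length P →
                  OccursAt (take n P) T q → OccursIn (at T) q (at P) n
occursAt-prefix {n = n} P T q n≤∣P∣ occurs i i<n =
  begin
    at T (q + i)                                ≡⟨ sym (at-drop q T i) ⟩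
    at (drop q T) i                             ≡⟨ sym (at-take _ (drop q T) i<∣P'∣) ⟩
    at (take (length (take n P)) (drop q T)) i  ≡⟨ cong (λ w → at w i) occurs ⟩
    at (take n P) i                             ≡⟨ at-take n P i<n ⟩
    at P i                                      ∎
  where
  i<∣P'∣ : i < length (take n P)
  i<∣P'∣ = subst (i <_) (sym (length-prefix P n≤∣P∣)) i<n

prefix-period : ∀ {n ρ} (P : List A) → n ≤ length P → 0 < ρ → ρ ≤ n →
                PeriodicOn (at P) ρ 0 n → IsPeriodOf ρ (take n P)
prefix-period {n = n} {ρ} P n≤∣P∣ 0<ρ ρ≤n per =
  0<ρ , subst (ρ ≤_) (sym ∣P'∣≡n) ρ≤n , λ i i<∣P'∣ i+ρ<∣P'∣ →
    let i+ρ<n = subst (i + ρ <_) ∣P'∣≡n i+ρ<∣P'∣ in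
    just-injective (begin
      just (lookup P' (fromℕ< i<∣P'∣))  ≡⟨ sym (at-lookup P' i<∣P'∣) ⟩
      at P' i                          ≡⟨ at-take n P (subst (i <_) ∣P'∣≡n i<∣P'∣) ⟩
      at P i                           ≡⟨ per i z≤n i+ρ<n ⟩
      at P (i + ρ)                     ≡⟨ sym (at-take n P i+ρ<n) ⟩
      at P' (i + ρ)                    ≡⟨ at-lookup P' i+ρ<∣P'∣ ⟩
      just (lookup P' (fromℕ< i+ρ<∣P'∣)) ∎)
  where
  P' : List _
  P' = take n P

  ∣P'∣≡n : length P' ≡ n
  ∣P'∣≡n = length-prefix P n≤∣P∣

-- The theorem.
lemma5 : ∀ {a : Level} {A : Set a}
    (k m : ℕ) → 0 < k → 0 < m →
    (P : List A) (j : ℕ) → 1 ≤ j → 2 ^ j ≤ length P →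
    (ρ₀ ρ₁ : ℕ) →
    IsThePeriod ρ₀ (take (2 ^ (j ∸ 1)) P) →
    IsThePeriod ρ₁ (take (2 ^ j) P) →
    ρ₀ < k * logRound m → k * logRound m ≤ ρ₁ →
    (T : List A) (s : ℕ) (p : ℕ → ℕ) →
    (∀ t → t < s → OccursAt (take (2 ^ (j ∸ 1)) P) T (p t)) →
    (∀ t → suc t < s → p (suc t) ≡ p t + ρ₀) →
    ∀ t t' → t < s → t' < s →
    OccursAt (take (2 ^ j) P) T (p t) →
    OccursAt (take (2 ^ j) P) T (p t') →
    t ≡ t'
lemma5 k m _ _ P (suc j) _ n₁≤∣P∣ ρ₀ ρ₁ ((0<ρ₀ , ρ₀≤∣P₀∣ , _) , _) (_ , minimal₁)
       ρ₀<klog klog≤ρ₁ T s p matches₀ step t t' t<s t'<s match match' =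
  at-most-one no-two-matches (t<s , match) (t'<s , match')
  where
  n₀≤n₁ : 2 ^ j ≤ 2 ^ suc j
  n₀≤n₁ = m≤m+n (2 ^ j) _

  n₀≤∣P∣ : 2 ^ j ≤ length P
  n₀≤∣P∣ = ≤-trans n₀≤n₁ n₁≤∣P∣

  ρ₀≤n₀ : ρ₀ ≤ 2 ^ j
  ρ₀≤n₀ = subst (ρ₀ ≤_) (length-prefix P n₀≤∣P∣) ρ₀≤∣P₀∣

  open MatchProgression {u = at T} {g = at P} 0<ρ₀ ρ₀≤n₀
         (λ t t<s → occursAt-prefix P T (p t) n₀≤∣P∣ (matches₀ t t<s)) step

  no-two-matches : ∀ {t t'} → t < t' →
                   t < s × OccursAt (take (2 ^ suc j) P) T (p t) →
                   t' < s × OccursAt (take (2 ^ suc j) P) T (p t') → ⊥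
  no-two-matches t<t' (_ , match₁) (t'<s , match₂) =
    <⇒≱ (<-≤-trans ρ₀<klog klog≤ρ₁) (minimal₁ ρ₀ ρ₀-period)
    where
    ρ₀-period : IsPeriodOf ρ₀ (take (2 ^ suc j) P)
    ρ₀-period = prefix-period P n₁≤∣P∣ 0<ρ₀ (≤-trans ρ₀≤n₀ n₀≤n₁)
                  (two-matches-periodic t<t' t'<s
                    (occursAt-prefix P T _ n₁≤∣P∣ match₁) (occursAt-prefix P T _ n₁≤∣P∣ match₂))
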